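{- For all terms $s,t,u$: if $s \sqsupseteq t$ and $t \sqsupset u$, then $s \sqsupset^+ u$ (where $\sqsupset^+$ is the transitive closure of $\sqsupset$).
   Context: Simply typed terms: there is a single base type (sort) $\iota$; types are $\iota$ and $\sigma \Rightarrow \tau$. Given a set of typed variables (infinitely many of each type) and a possibly infinite set of typed function symbols, terms are built from variables and function symbols by type-respecting application: if $s :: \sigma \Rightarrow \tau$ and $t :: \sigma$ then $s\ t :: \tau$ (left-associative). Every term has the form $a\ s_1 \cdots s_n$ ($n\ge 0$) with $a$ a variable or function symbol. Fixed data: a precedence $\unrhd$ (a quasi-ordering on function symbols whose strict part $\rhd$ is well-founded; $\equiv$ denotes $\unrhd \cap \unlhd$), and a filter $\pi$ assigning to each $\mathsf{f} :: \sigma_1 \Rightarrow \dots \Rightarrow \sigma_m \Rightarrow \iota$ a set $\pi(\mathsf{f}) \subseteq \{1,\dots,m\}$; for each $\mathsf{f}$ the arities of the symbols $\mathsf{g} \equiv \mathsf{f}$ are bounded. Equivalence: $s \approx t$ iff $s,t$ have the same type and either (Eq-mono) $s = x\ s_1 \cdots s_n$, $t = x\ t_1 \cdots t_n$, $x$ a variable, $s_i \approx t_i$ for all $i$; or (Eq-args) $s = \mathsf{f}\ s_1 \cdots s_n$, $t = \mathsf{g}\ t_1 \cdots t_n$, $\mathsf{f},\mathsf{g}$ function symbols of the same type, $\mathsf{f} \equiv \mathsf{g}$, $\pi(\mathsf{f}) = \pi(\mathsf{g})$, $s_i \approx t_i$ for all $i \in \pi(\mathsf{f}) \cap \{1,\dots,n\}$.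 The relations $\sqsupseteq, \sqsupset, \sqsupset\!\!\sqsupset$ are the least relations such that: $s \sqsupseteq t$ iff $s \approx t$ or $s \sqsupset t$. $s \sqsupset t$ if $s,t$ have the same type and one of: (Gr-mono) $s = x\ s_1 \cdots s_n$, $t = x\ t_1 \cdots t_n$, $x$ a variable, $s_i \sqsupseteq t_i$ for all $i$ and $s_i \sqsupset t_i$ for some $i$; (Gr-args) $s = \mathsf{f}\ s_1 \cdots s_n$, $t = \mathsf{g}\ t_1 \cdots t_n$, $\mathsf{f},\mathsf{g}$ of the same type, $\mathsf{f} \equiv \mathsf{g}$, $\pi(\mathsf{f}) = \pi(\mathsf{g})$, $s_i \sqsupseteq t_i$ for all $i \in \pi(\mathsf{f}) \cap \{1,\dots,n\}$ and $s_i \sqsupset t_i$ for some such $i$; (Gr-rpo) $s \sqsupset\!\!\sqsupset t$. $s \sqsupset\!\!\sqsupset t$ ($s,t$ possibly of different types) if $s = \mathsf{f}\ s_1 \cdots s_n$ with $\mathsf{f} :: \sigma_1 \Rightarrow \dots \Rightarrow \sigma_m \Rightarrow \iota$, $\{n+1,\dots,m\} \subseteq \pi(\mathsf{f})$, and one of: (Rpo-select) $s_i \sqsupseteq t$ for some $i \in \pi(\mathsf{f}) \cap \{1,\dots,n\}$; (Rpo-appl) $t = t_0\ t_1 \cdots t_k$ with $k \ge 1$ and $s \sqsupset\!\!\sqsupset t_i$ for all $0 \le i \le k$; (Rpo-copy) $t = \mathsf{g}\ t_1 \cdots t_k$ with $\mathsf{f} \rhd \mathsf{g}$ and $s \sqsupset\!\!\sqsupset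 t_i$ for all $i \in \pi(\mathsf{g}) \cap \{1,\dots,k\}$; (Rpo-lex) $t = \mathsf{g}\ t_1 \cdots t_k$ with $\mathsf{f} \equiv \mathsf{g}$ and there is $i \in \pi(\mathsf{f}) \cap \pi(\mathsf{g}) \cap \{1,\dots,\min(n,k)\}$ with $\pi(\mathsf{f}) \cap \{1,\dots,i\} = \pi(\mathsf{g}) \cap \{1,\dots,i\}$, $s_j \approx t_j$ for all $j \in \{1,\dots,i-1\} \cap \pi(\mathsf{f})$, $s_i \sqsupset t_i$, and $s \sqsupset\!\!\sqsupset t_j$ for all $j \in \{i+1,\dots,k\} \cap \pi(\mathsf{g})$. -}

module Defs where

open import Data.Nat using (ℕ; zero; suc; _≤_; _<_)
open import Data.Bool using (Bool; true; false)
open import Data.Product using (_×_; Σ; ∃; _,_)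
open import Relation.Nullary using (¬_)
open import Relation.Binary.PropositionalEquality using (_≡_)
open import Induction.WellFounded using (WellFounded)

infixr 5 _⇒_
data Ty : Set where
  ι   : Ty
  _⇒_ : Ty → Ty → Ty

arity : Ty → ℕ
arity ι       = zero
arity (_ ⇒ τ) = suc (arity τ)

record Setting : Set₁ where
  field
    Sym    : Set
    type   : Sym → Ty
    _⊵_    : Sym → Sym → Set
    ⊵-refl  : ∀ f → f ⊵ f
    ⊵-trans : ∀ {f g h} → f ⊵ g → g ⊵ h → f ⊵ h
    -- strict part f ▷ g := f ⊵ g ∧ ¬ g ⊵ f is well-founded
    -- (no infinite descending chain f₀ ▷ f₁ ▷ …)
    ▷-wf   : WellFounded (λ g f → (f ⊵ g) × ¬ (g ⊵ f))
    -- filter: π f ⊆ {1,…,arity (type f)}, as a characteristic function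
    π      : Sym → ℕ → Bool
    π-range : ∀ f i → π f i ≡ true → (1 ≤ i) × (i ≤ arity (type f))
    ≡-bounded : ∀ f → ∃ λ B → ∀ g → f ⊵ g → g ⊵ f → arity (type g) ≤ B

module Terms (S : Setting) where
  open Setting S

  _▷_ : Sym → Sym → Set
  f ▷ g = (f ⊵ g) × ¬ (g ⊵ f)

  _≡ₚ_ : Sym → Sym → Set
  f ≡ₚ g = (f ⊵ g) × (g ⊵ f)

  data Head : Ty → Set where
    var : ∀ {σ} → ℕ → Head σ
    fun : (f : Sym) → Head (type f)

  -- terms in spine form  a s₁ ⋯ sₙ ; Args σ τ is a list of arguments
  -- turning something of type σ into something of type τ
  mutual
    data Term : Ty → Set where
      _·_ : ∀ {σ τ} → Head σ → Args σ τ → Term τ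

    data Args : Ty → Ty → Set where
      []  : ∀ {σ} → Args σ σ
      _∷_ : ∀ {σ τ ρ} → Term σ → Args τ ρ → Args (σ ⇒ τ) ρ

  infixr 5 _∷_
  infix 4 _·_

  len : ∀ {σ τ} → Args σ τ → ℕ
  len []       = zero
  len (_ ∷ as) = suc (len as)

  _++_ : ∀ {σ τ ρ} → Args σ τ → Args τ ρ → Args σ ρ
  []       ++ bs = bs
  (a ∷ as) ++ bs = a ∷ (as ++ bs)

  -- Arg as i a : the i-th argument (1-based) of the list as is a
  data Arg : ∀ {σ τ ρ} → Args σ τ → ℕ → Term ρ → Set where
    here  : ∀ {σ τ ρ} {a : Term σ} {as : Args τ ρ} → Arg (a ∷ as) 1 a
    there : ∀ {σ τ ρ ρ'} {a : Term σ} {as : Args τ ρ} {i} {b : Term ρ'} →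
            Arg as i b → Arg (a ∷ as) (suc i) b

  -- Equivalence ≈ (only relates terms of the same type)
  data _≈_ : ∀ {σ τ} → Term σ → Term τ → Set where
    eq-mono : ∀ {σ τ} {x : ℕ} {ss ts : Args σ τ} →
              (∀ {i ρ ρ'} {a : Term ρ} {b : Term ρ'} →
                 Arg ss i a → Arg ts i b → a ≈ b) →
              (var x · ss) ≈ (var x · ts)
    eq-args : ∀ {f g τ} (e : type f ≡ type g)
              {ss : Args (type f) τ} {ts : Args (type g) τ} →
              f ≡ₚ g → (∀ i → π f i ≡ π g i) →
              (∀ {i ρ ρ'} {a : Term ρ} {b : Term ρ'} → π f i ≡ true →
                 Arg ss i a → Arg ts i b → a ≈ b) →
              (fun f · ss) ≈ (fun g · ts)

  Saturated : (f : Sym) → ℕ → Set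
  Saturated f n = ∀ j → n < j → j ≤ arity (type f) → π f j ≡ true

  mutual
    data _⊒_ : ∀ {σ τ} → Term σ → Term τ → Set where
      ge-eq : ∀ {σ τ} {s : Term σ} {t : Term τ} → s ≈ t → s ⊒ t
      ge-gr : ∀ {σ τ} {s : Term σ} {t : Term τ} → s ⊐ t → s ⊒ t

    -- s ⊐ t (only relates terms of the same type)
    data _⊐_ : ∀ {σ τ} → Term σ → Term τ → Set where
      gr-mono : ∀ {σ τ} {x : ℕ} {ss ts : Args σ τ} →
                (∀ {i ρ ρ'} {a : Term ρ} {b : Term ρ'} →
                   Arg ss i a → Arg ts i b → a ⊒ b) →
                (Σ ℕ λ i → Σ Ty λ ρ → Σ Ty λ ρ' → Σ (Term ρ) λ a → Σ (Term ρ') λ b →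
                   Arg ss i a × Arg ts i b × a ⊐ b) →
                (var x · ss) ⊐ (var x · ts)
      gr-args : ∀ {f g τ} (e : type f ≡ type g)
                {ss : Args (type f) τ} {ts : Args (type g) τ} →
                f ≡ₚ g → (∀ i → π f i ≡ π g i) →
                (∀ {i ρ ρ'} {a : Term ρ} {b : Term ρ'} → π f i ≡ true →
                   Arg ss i a → Arg ts i b → a ⊒ b) →
                (Σ ℕ λ i → Σ Ty λ ρ → Σ Ty λ ρ' → Σ (Term ρ) λ a → Σ (Term ρ') λ b →
                   π f i ≡ true × Arg ss i a × Arg ts i b × a ⊐ b) →
                (fun f · ss) ⊐ (fun g · ts)
      gr-rpo  : ∀ {σ} {s t : Term σ} → s ⊐⊐ t → s ⊐ t

    -- s ⊐⊐ t (s, t possibly of different types)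
    data _⊐⊐_ : ∀ {σ τ} → Term σ → Term τ → Set where
      rpo-select : ∀ {f σ τ ρ} {ss : Args (type f) σ} {t : Term τ} →
                   Saturated f (len ss) →
                   ∀ i {a : Term ρ} → π f i ≡ true → Arg ss i a → a ⊒ t →
                   (fun f · ss) ⊐⊐ t
      rpo-appl   : ∀ {f σ α β γ δ} {ss : Args (type f) σ}
                   (h : Head α) (pre : Args α (γ ⇒ δ)) (t₁ : Term γ) (suf : Args δ β) →
                   -- t = t₀ t₁ ⋯ tₖ with t₀ = h pre, k ≥ 1
                   Saturated f (len ss) →
                   (fun f · ss) ⊐⊐ (h · pre) →
                   (fun f · ss) ⊐⊐ t₁ →
                   (∀ {i ρ} {a : Term ρ} → Arg suf i a → (fun f · ss) ⊐⊐ a) →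
                   (fun f · ss) ⊐⊐ (h · (pre ++ (t₁ ∷ suf)))
      rpo-copy   : ∀ {f g σ τ} {ss : Args (type f) σ} {ts : Args (type g) τ} →
                   Saturated f (len ss) →
                   f ▷ g →
                   (∀ {i ρ} {a : Term ρ} → π g i ≡ true → Arg ts i a →
                      (fun f · ss) ⊐⊐ a) →
                   (fun f · ss) ⊐⊐ (fun g · ts)
      rpo-lex    : ∀ {f g σ τ ρ ρ'} {ss : Args (type f) σ} {ts : Args (type g) τ} →
                   Saturated f (len ss) →
                   f ≡ₚ g →
                   ∀ i {a : Term ρ} {b : Term ρ'} →
                   π f i ≡ true → π g i ≡ true →
                   (∀ j → 1 ≤ j → j ≤ i → π f j ≡ π g j) →
                   (∀ {j ρ₁ ρ₂} {c : Term ρ₁} {d : Term ρ₂} → j < i → π f j ≡ true →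
                      Arg ss j c → Arg ts j d → c ≈ d) →
                   Arg ss i a → Arg ts i b → a ⊐ b →
                   (∀ {j ρ₁} {d : Term ρ₁} → i < j → π g j ≡ true → Arg ts j d →
                      (fun f · ss) ⊐⊐ d) →
                   (fun f · ss) ⊐⊐ (fun g · ts)

  _⊐⁺_ : ∀ {σ} → Term σ → Term σ → Set
  _⊐⁺_ {σ} = TransClosure (_⊐_ {σ} {σ})
    where open import Relation.Binary.Construct.Closure.Transitive using (TransClosure)

{-# OPTIONS --safe #-}
module Submission where

open import Defs
open import Data.Nat using (ℕ; suc; _≤_; _<_)
open import Data.Nat.Properties using (≤-refl; m≤n⇒m≤1+n; 1+n≰n)
open import Data.Product using (_,_)
open import Data.Empty using (⊥-elim)
open import Relation.Nullary using (¬_)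
open import Relation.Binary.PropositionalEquality using (_≡_; _≗_; refl; sym; trans; cong; subst)
open import Relation.Binary.Construct.Closure.Transitive using ([_]; _∷_)

-- If s ⊐ t then s ⊐ t ⊐ u is already a chain, so the content is the case s ≈ t,
-- where s ⊐ u holds outright: ≈ is transitive and ⊒, ⊐, ⊐⊐ are closed under ≈ on
-- the left.  The closure follows by a simultaneous induction on the derivation of
-- the right-hand relation, rebuilding it with the head and arguments of s in place
-- of those of t.  This works because ≈-related heads are equivalent in the
-- precedence and have the same type and filter, and argument lists between the
-- same two types have the same length (each argument lowers the arity by one), so
-- saturation and argument positions carry over.

module _ (S : Setting) where
  open Setting S
  open Terms S

  ≡ₚ-trans : ∀ {f g h} → f ≡ₚ g → g ≡ₚ h → f ≡ₚ h
  ≡ₚ-trans (f⊵g , g⊵f) (g⊵h , h⊵g) = ⊵-trans f⊵g g⊵h , ⊵-trans h⊵g g⊵f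

  ≡ₚ-▷-trans : ∀ {f g h} → f ≡ₚ g → g ▷ h → f ▷ h
  ≡ₚ-▷-trans (f⊵g , _) (g⊵h , h⋭g) = ⊵-trans f⊵g g⊵h , λ h⊵f → h⋭g (⊵-trans h⊵f f⊵g)

  arity-≤-Args : ∀ {σ τ} → Args σ τ → arity τ ≤ arity σ
  arity-≤-Args []       = ≤-refl
  arity-≤-Args (_ ∷ as) = m≤n⇒m≤1+n (arity-≤-Args as)

  ¬Args-⇒ : ∀ {ρ τ} → ¬ Args τ (ρ ⇒ τ)
  ¬Args-⇒ as = 1+n≰n (arity-≤-Args as)

  len-unique : ∀ {σ σ' τ} → σ ≡ σ' → (ss : Args σ τ) (ts : Args σ' τ) → len ss ≡ len ts
  len-unique refl []       []       = refl
  len-unique refl []       (_ ∷ ts) = ⊥-elim (¬Args-⇒ ts)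
  len-unique refl (_ ∷ ss) []       = ⊥-elim (¬Args-⇒ ss)
  len-unique refl (_ ∷ ss) (_ ∷ ts) = cong suc (len-unique refl ss ts)

  record ArgAt {σ τ} (ts : Args σ τ) (i : ℕ) : Set where
    constructor argAt
    field
      {ρ} : Ty
      {b} : Term ρ
      at  : Arg ts i b
  open ArgAt using (at)

  matchingArg : ∀ {σ σ' τ i ρ} {a : Term ρ} {ss : Args σ τ} {ts : Args σ' τ} →
                σ ≡ σ' → Arg ss i a → ArgAt ts i
  matchingArg {ts = []}     refl (here {as = as})    = ⊥-elim (¬Args-⇒ as)
  matchingArg {ts = _ ∷ _}  refl here                = argAt here
  matchingArg {ts = []}     refl (there {as = as} _) = ⊥-elim (¬Args-⇒ as)
  matchingArg {ts = _ ∷ _}  refl (there p)           = argAt (there (matchingArg refl p .at))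

  Saturated-transfer : ∀ {f g τ} {ss : Args (type f) τ} {ts : Args (type g) τ} →
                       type f ≡ type g → π f ≗ π g →
                       Saturated g (len ts) → Saturated f (len ss)
  Saturated-transfer {ss = ss} {ts} e πf≗πg sat j n<j j≤m =
    trans (πf≗πg j) (sat j (subst (_< j) (len-unique e ss ts) n<j)
                           (subst (j ≤_) (cong arity e) j≤m))

  ≈-type : ∀ {σ τ} {a : Term σ} {b : Term τ} → a ≈ b → σ ≡ τ
  ≈-type (eq-mono _)        = refl
  ≈-type (eq-args _ _ _ _) = refl

  ≈-trans : ∀ {σ τ ρ} {a : Term σ} {b : Term τ} {c : Term ρ} → a ≈ b → b ≈ c → a ≈ c
  ≈-trans (eq-mono {ts = ts} ss≈ts) (eq-mono ts≈us) =
    eq-mono λ p q → let r = matchingArg {ts = ts} refl p .at in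
      ≈-trans (ss≈ts p r) (ts≈us r q)
  ≈-trans (eq-args e {ts = ts} f≡g πf≗πg ss≈ts) (eq-args e' g≡h πg≗πh ts≈us) =
    eq-args (trans e e') (≡ₚ-trans f≡g g≡h) (λ i → trans (πf≗πg i) (πg≗πh i))
      λ πi p q → let r = matchingArg {ts = ts} e p .at in
        ≈-trans (ss≈ts πi p r) (ts≈us (trans (sym (πf≗πg _)) πi) r q)

  mutual
    ≈-⊒-trans : ∀ {σ τ ρ} {a : Term σ} {b : Term τ} {c : Term ρ} → a ≈ b → b ⊒ c → a ⊒ c
    ≈-⊒-trans a≈b (ge-eq b≈c) = ge-eq (≈-trans a≈b b≈c)
    ≈-⊒-trans a≈b (ge-gr b⊐c) = ge-gr (≈-⊐-trans a≈b b⊐c)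

    ≈-⊐-trans : ∀ {σ τ ρ} {a : Term σ} {b : Term τ} {c : Term ρ} → a ≈ b → b ⊐ c → a ⊐ c
    ≈-⊐-trans (eq-mono {ss = ss} {ts} ss≈ts) (gr-mono ts⊒us (i , _ , _ , _ , _ , pt , pu , t⊐u)) =
      gr-mono (λ p q → let r = matchingArg {ts = ts} refl p .at in
                 ≈-⊒-trans (ss≈ts p r) (ts⊒us r q))
              (let r = matchingArg {ts = ss} refl pt .at in
                 i , _ , _ , _ , _ , r , pu , ≈-⊐-trans (ss≈ts r pt) t⊐u)
    ≈-⊐-trans (eq-args e {ss = ss} {ts} f≡g πf≗πg ss≈ts)
              (gr-args e' g≡h πg≗πh ts⊒us (i , _ , _ , _ , _ , πg-i , pt , pu , t⊐u)) =
      gr-args (trans e e') (≡ₚ-trans f≡g g≡h) (λ j → trans (πf≗πg j) (πg≗πh j))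
              (λ πj p q → let r = matchingArg {ts = ts} e p .at in
                 ≈-⊒-trans (ss≈ts πj p r) (ts⊒us (trans (sym (πf≗πg _)) πj) r q))
              (let r = matchingArg {ts = ss} (sym e) pt .at
                   πf-i = trans (πf≗πg i) πg-i in
                 i , _ , _ , _ , _ , πf-i , r , pu , ≈-⊐-trans (ss≈ts πf-i r pt) t⊐u)
    ≈-⊐-trans a≈b (gr-rpo b⊐⊐c) with ≈-type a≈b
    ... | refl = gr-rpo (≈-⊐⊐-trans a≈b b⊐⊐c)

    ≈-⊐⊐-trans : ∀ {σ τ ρ} {a : Term σ} {b : Term τ} {c : Term ρ} → a ≈ b → b ⊐⊐ c → a ⊐⊐ c
    ≈-⊐⊐-trans (eq-args e {ss = ss} _ πf≗πg ss≈ts) (rpo-select sat i πg-i pt t⊒u) =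
      let r = matchingArg {ts = ss} (sym e) pt .at
          πf-i = trans (πf≗πg i) πg-i in
      rpo-select (Saturated-transfer e πf≗πg sat) i πf-i r (≈-⊒-trans (ss≈ts πf-i r pt) t⊒u)
    ≈-⊐⊐-trans a≈b@(eq-args e _ πf≗πg _) (rpo-appl h pre t₁ suf sat t⊐⊐h t⊐⊐t₁ t⊐⊐suf) =
      rpo-appl h pre t₁ suf (Saturated-transfer e πf≗πg sat)
               (≈-⊐⊐-trans a≈b t⊐⊐h) (≈-⊐⊐-trans a≈b t⊐⊐t₁) (λ p → ≈-⊐⊐-trans a≈b (t⊐⊐suf p))
    ≈-⊐⊐-trans a≈b@(eq-args e f≡g πf≗πg _) (rpo-copy sat g▷h t⊐⊐us) =
      rpo-copy (Saturated-transfer e πf≗πg sat) (≡ₚ-▷-trans f≡g g▷h)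
               (λ πj p → ≈-⊐⊐-trans a≈b (t⊐⊐us πj p))
    ≈-⊐⊐-trans a≈b@(eq-args e {ss = ss} {ts} f≡g πf≗πg ss≈ts)
               (rpo-lex sat g≡h i πg-i πh-i πg≗πh-≤i ts≈us pt pu t⊐u t⊐⊐us) =
      let r = matchingArg {ts = ss} (sym e) pt .at
          πf-i = trans (πf≗πg i) πg-i in
      rpo-lex (Saturated-transfer e πf≗πg sat) (≡ₚ-trans f≡g g≡h) i πf-i πh-i
              (λ j 1≤j j≤i → trans (πf≗πg j) (πg≗πh-≤i j 1≤j j≤i))
              (λ j<i πj p q → let r' = matchingArg {ts = ts} e p .at in
                 ≈-trans (ss≈ts πj p r') (ts≈us j<i (trans (sym (πf≗πg _)) πj) r' q))
              r pu (≈-⊐-trans (ss≈ts πf-i r pt) t⊐u)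
              (λ i<j πj p → ≈-⊐⊐-trans a≈b (t⊐⊐us i<j πj p))

  ⊒-⊐-trans⁺ : ∀ {σ} {s t u : Term σ} → s ⊒ t → t ⊐ u → s ⊐⁺ u
  ⊒-⊐-trans⁺ (ge-eq s≈t) t⊐u = [ ≈-⊐-trans s≈t t⊐u ]
  ⊒-⊐-trans⁺ (ge-gr s⊐t) t⊐u = s⊐t ∷ [ t⊐u ]

corollary4 : (S : Setting) → let open Terms S in
    ∀ {σ} {s t u : Term σ} → s ⊒ t → t ⊐ u → s ⊐⁺ u
corollary4 = ⊒-⊐-trans⁺
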